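{- Let $n\ge 1$ be an integer and let $\mathrm{EGZ}_n$ denote the set of multisets of size $n$ with elements in the cyclic group $\mathbb{Z}_n$ whose sum is congruent to $\binom{n}{2}$ modulo $n$. Then there is a one-to-one correspondence between $\mathrm{EGZ}_n$ and the set of $n$-element subsets of $\{1,2,\dots,2n-1\}$ whose sum is a multiple of $n$. -}

module Defs where

open import Data.Nat using (ℕ; zero; suc; _+_; _*_; _∸_; _%_; NonZero)
open import Data.Nat.Combinatorics using (_C_)
open import Data.Nat.Divisibility using (_∣_)
open import Data.Fin using (Fin; toℕ)
open import Data.Vec using (Vec; []; _∷_; lookup)
open import Data.Bool using (Bool; true; false; if_then_else_)
open import Data.Fin.Subset using (Subset; ∣_∣)
open import Data.Product using (Σ; _×_)
open import Relation.Binary.PropositionalEquality using (_≡_)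

Σfin : (k : ℕ) → (Fin k → ℕ) → ℕ
Σfin zero    f = 0
Σfin (suc k) f = f Fin.zero + Σfin k (λ i → f (Fin.suc i))

-- A multiset with elements in ℤ_n = Fin n, given by its multiplicity
-- vector: entry i is the number of copies of the residue i.
Multiset : ℕ → Set
Multiset n = Vec ℕ n

msize : {n : ℕ} → Multiset n → ℕ
msize {n} m = Σfin n (lookup m)

msum : {n : ℕ} → Multiset n → ℕ
msum {n} m = Σfin n (λ i → lookup m i * toℕ i)

EGZ : (n : ℕ) → {{NonZero n}} → Set
EGZ n = Σ (Multiset n) (λ m → msize m ≡ n × msum m % n ≡ (n C 2) % n)

-- Subsets of {1,…,2n-1}: a Subset (2n-1); index i : Fin (2n-1) stands for i+1.
subsetSum : {k : ℕ} → Subset k → ℕ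
subsetSum {k} p = Σfin k (λ i → if lookup p i then suc (toℕ i) else 0)

GoodSubsets : ℕ → Set
GoodSubsets n = Σ (Subset (2 * n ∸ 1)) (λ p → ∣ p ∣ ≡ n × n ∣ subsetSum p)

-- Stars and bars: the multiset with multiplicities m₀, …, m_{n-1} is the bit
-- string 1^{m₀} 0 1^{m₁} 0 ⋯ 0 1^{m_{n-1}} of length 2n-1, and its n ones form
-- the subset.  A one preceded by i zeros and j-1 ones sits at position i + j,
-- so the subset sum is Σ i·mᵢ + (1 + ⋯ + n).  As C(n,2) + (1 + ⋯ + n) = n²,
-- n divides the subset sum exactly when Σ i·mᵢ ≡ C(n,2) (mod n).
module Submission where

open import Defs
open import Data.Nat using (ℕ; NonZero; zero; suc; _+_; _*_; _∸_; _%_)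
open import Data.Nat.Properties
  using (+-suc; *-suc; *-zeroʳ; +-comm; suc-injective; +-cancelˡ-≡; *-cancelʳ-≡; ≡-irrelevant; +-commutativeSemigroup)
open import Algebra.Properties.CommutativeSemigroup +-commutativeSemigroup using (interchange; x∙yz≈y∙xz)
open import Data.Nat.DivMod using ([m+kn]%n≡m%n; %-distribˡ-+)
open import Data.Nat.Divisibility using (_∣_; divides; m%n≡0⇒n∣m; n∣m⇒m%n≡0)
open import Data.Nat.Combinatorics using (_C_; nC1≡n; nCk+nC[k+1]≡[n+1]C[k+1])
open import Data.Nat.Solver using (module +-*-Solver)
open import Data.Fin using (Fin; toℕ)
open import Data.Vec using (Vec; []; _∷_; lookup; replicate; toList; fromList; cast)
open import Data.Vec.Properties using (toList∘fromList; toList-injective; length-toList)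
open import Data.List using (List; []; _∷_; length)
open import Data.Bool using (Bool; true; false; if_then_else_)
open import Data.Fin.Subset using (Subset; ∣_∣)
open import Data.Product using (Σ; _×_; _,_; proj₁)
open import Relation.Nullary.Irrelevant using (Irrelevant)
open import Relation.Binary.PropositionalEquality
open import Function.Bundles using (_⤖_; _↔_; mk↔ₛ′)
open import Function.Properties.Inverse using (↔⇒⤖)

open +-*-Solver
open ≡-Reasoning

private
  variable
    A : Set
    k m r : ℕ

Σfin-cong : ∀ k {f g : Fin k → ℕ} → (∀ i → f i ≡ g i) → Σfin k f ≡ Σfin k g
Σfin-cong zero    f≗g = refl
Σfin-cong (suc k) f≗g = cong₂ _+_ (f≗g Fin.zero) (Σfin-cong k (λ i → f≗g (Fin.suc i)))

Σfin-+ : ∀ k (f g : Fin k → ℕ) → Σfin k (λ i → f i + g i) ≡ Σfin k f + Σfin k g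
Σfin-+ zero    f g = refl
Σfin-+ (suc k) f g =
  trans (cong (f Fin.zero + g Fin.zero +_) (Σfin-+ k _ _)) (interchange (f Fin.zero) (g Fin.zero) _ _)

toList-cast : .(eq : k ≡ m) (xs : Vec A k) → toList (cast eq xs) ≡ toList xs
toList-cast {m = zero}  eq []       = refl
toList-cast {m = suc m} eq (x ∷ xs) = cong (x ∷_) (toList-cast (suc-injective eq) xs)

∣-irrelevant : ∀ {m n} → Irrelevant (suc m ∣ n)
∣-irrelevant {m} (divides q₁ eq₁) (divides q₂ eq₂)
  with refl ← *-cancelʳ-≡ q₁ q₂ (suc m) (trans (sym eq₁) eq₂)
  = cong (divides q₁) (≡-irrelevant eq₁ eq₂)

Σ-↔-irrelevant : {B : Set} {P : A → Set} {Q : B → Set} →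
                 (∀ {a} → Irrelevant (P a)) → (∀ {b} → Irrelevant (Q b)) →
                 (to : Σ A P → B) (from : Σ B Q → A)
                 (to-Q : ∀ x → Q (to x)) (from-P : ∀ y → P (from y)) →
                 (∀ x → from (to x , to-Q x) ≡ proj₁ x) →
                 (∀ y → to (from y , from-P y) ≡ proj₁ y) →
                 Σ A P ↔ Σ B Q
Σ-↔-irrelevant P-irr Q-irr to from to-Q from-P from-to to-from =
  mk↔ₛ′ (λ x → to x , to-Q x) (λ y → from y , from-P y)
        (λ y → subtype-≡ Q-irr (to-from y)) (λ x → subtype-≡ P-irr (from-to x))
  where
    subtype-≡ : ∀ {X : Set} {R : X → Set} → (∀ {c} → Irrelevant (R c)) →
                {x y : Σ X R} → proj₁ x ≡ proj₁ y → x ≡ y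
    subtype-≡ R-irr {c , p} {.c , q} refl = cong (c ,_) (R-irr p q)

trues : List Bool → ℕ
trues []          = 0
trues (true ∷ l)  = suc (trues l)
trues (false ∷ l) = trues l

falses : List Bool → ℕ
falses []          = 0
falses (true ∷ l)  = falses l
falses (false ∷ l) = suc (falses l)

positionSum : List Bool → ℕ
positionSum []      = 0
positionSum (b ∷ l) = (if b then 1 else 0) + (positionSum l + trues l)

length≡trues+falses : ∀ l → length l ≡ trues l + falses l
length≡trues+falses []          = refl
length≡trues+falses (true ∷ l)  = cong suc (length≡trues+falses l)
length≡trues+falses (false ∷ l) = trans (cong suc (length≡trues+falses l)) (sym (+-suc (trues l) (falses l)))

∣p∣≡trues : (p : Subset k) → ∣ p ∣ ≡ trues (toList p)
∣p∣≡trues []          = refl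
∣p∣≡trues (true ∷ p)  = cong suc (∣p∣≡trues p)
∣p∣≡trues (false ∷ p) = ∣p∣≡trues p

∣p∣≡Σfin : (p : Subset k) → ∣ p ∣ ≡ Σfin k (λ i → if lookup p i then 1 else 0)
∣p∣≡Σfin []          = refl
∣p∣≡Σfin (true ∷ p)  = cong suc (∣p∣≡Σfin p)
∣p∣≡Σfin (false ∷ p) = ∣p∣≡Σfin p

subsetSum-∷ : ∀ b (p : Subset k) → subsetSum (b ∷ p) ≡ (if b then 1 else 0) + (subsetSum p + ∣ p ∣)
subsetSum-∷ {k} b p = cong ((if b then 1 else 0) +_) (begin
    Σfin k (λ i → if lookup p i then suc (suc (toℕ i)) else 0)
  ≡⟨ Σfin-cong k (λ i → shift (lookup p i) (toℕ i)) ⟩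
    Σfin k (λ i → (if lookup p i then suc (toℕ i) else 0) + (if lookup p i then 1 else 0))
  ≡⟨ Σfin-+ k _ _ ⟩
    subsetSum p + Σfin k (λ i → if lookup p i then 1 else 0)
  ≡⟨ cong (subsetSum p +_) (∣p∣≡Σfin p) ⟨
    subsetSum p + ∣ p ∣
  ∎)
  where
    shift : ∀ c t → (if c then suc (suc t) else 0) ≡ (if c then suc t else 0) + (if c then 1 else 0)
    shift true  t = cong suc (+-comm 1 t)
    shift false t = refl

subsetSum≡positionSum : (p : Subset k) → subsetSum p ≡ positionSum (toList p)
subsetSum≡positionSum []      = refl
subsetSum≡positionSum (b ∷ p) =
  trans (subsetSum-∷ b p) (cong₂ (λ s t → (if b then 1 else 0) + (s + t)) (subsetSum≡positionSum p) (∣p∣≡trues p))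

falses-toList : (p : Subset k) → k ≡ m + r → ∣ p ∣ ≡ m → falses (toList p) ≡ r
falses-toList {k} {m} {r} p k≡m+r ∣p∣≡m = +-cancelˡ-≡ m (falses (toList p)) r (begin
    m + falses (toList p)
  ≡⟨ cong (_+ falses (toList p)) (trans (sym ∣p∣≡m) (∣p∣≡trues p)) ⟩
    trues (toList p) + falses (toList p)
  ≡⟨ length≡trues+falses (toList p) ⟨
    length (toList p)
  ≡⟨ trans (length-toList p) k≡m+r ⟩
    m + r
  ∎)

msum-∷ : ∀ a (ms : Vec ℕ k) → msum (a ∷ ms) ≡ msum ms + msize ms
msum-∷ {k} a ms = begin
    a * 0 + Σfin k (λ i → lookup ms i * suc (toℕ i))
  ≡⟨ cong₂ _+_ (*-zeroʳ a) (Σfin-cong k (λ i → *-suc (lookup ms i) (toℕ i))) ⟩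
    Σfin k (λ i → lookup ms i + lookup ms i * toℕ i)
  ≡⟨ Σfin-+ k _ _ ⟩
    msize ms + msum ms
  ≡⟨ +-comm (msize ms) (msum ms) ⟩
    msum ms + msize ms
  ∎

encode : Vec ℕ (suc r) → List Bool
encode (suc a ∷ ms)    = true ∷ encode (a ∷ ms)
encode (zero ∷ [])     = []
encode (zero ∷ m ∷ ms) = false ∷ encode (m ∷ ms)

sucHead : Vec ℕ (suc r) → Vec ℕ (suc r)
sucHead (a ∷ ms) = suc a ∷ ms

-- Strings with fewer than r zeros are padded with empty classes and zeros
-- beyond the r-th are dropped; encode-decode only concerns exactly r zeros.
decode : ∀ r → List Bool → Vec ℕ (suc r)
decode r       []          = replicate (suc r) 0
decode r       (true ∷ l)  = sucHead (decode r l)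
decode zero    (false ∷ l) = decode zero l
decode (suc r) (false ∷ l) = 0 ∷ decode r l

decode-encode : (v : Vec ℕ (suc r)) → decode r (encode v) ≡ v
decode-encode (suc a ∷ ms)    = cong sucHead (decode-encode (a ∷ ms))
decode-encode (zero ∷ [])     = refl
decode-encode (zero ∷ m ∷ ms) = cong (0 ∷_) (decode-encode (m ∷ ms))

encode-sucHead : (v : Vec ℕ (suc r)) → encode (sucHead v) ≡ true ∷ encode v
encode-sucHead (a ∷ ms) = refl

encode-zero∷ : (v : Vec ℕ (suc r)) → encode (0 ∷ v) ≡ false ∷ encode v
encode-zero∷ (a ∷ ms) = refl

encode-decode : ∀ r l → falses l ≡ r → encode (decode r l) ≡ l
encode-decode .0 []          refl = refl
encode-decode r  (true ∷ l)  eq   =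
  trans (encode-sucHead (decode r l)) (cong (true ∷_) (encode-decode r l eq))
encode-decode (suc r) (false ∷ l) eq =
  trans (encode-zero∷ (decode r l)) (cong (false ∷_) (encode-decode r l (suc-injective eq)))

trues-encode : (v : Vec ℕ (suc r)) → trues (encode v) ≡ msize v
trues-encode (suc a ∷ ms)    = cong suc (trues-encode (a ∷ ms))
trues-encode (zero ∷ [])     = refl
trues-encode (zero ∷ m ∷ ms) = trues-encode (m ∷ ms)

falses-encode : (v : Vec ℕ (suc r)) → falses (encode v) ≡ r
falses-encode (suc a ∷ ms)    = falses-encode (a ∷ ms)
falses-encode (zero ∷ [])     = refl
falses-encode (zero ∷ m ∷ ms) = cong suc (falses-encode (m ∷ ms))

length-encode : (v : Vec ℕ (suc r)) → length (encode v) ≡ msize v + r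
length-encode v = trans (length≡trues+falses (encode v)) (cong₂ _+_ (trues-encode v) (falses-encode v))

triangle : ℕ → ℕ
triangle zero    = 0
triangle (suc k) = suc k + triangle k

positionSum-encode : (v : Vec ℕ (suc r)) → positionSum (encode v) ≡ msum v + triangle (msize v)
positionSum-encode (suc a ∷ ms) =
  begin
    1 + (positionSum (encode (a ∷ ms)) + trues (encode (a ∷ ms)))
  ≡⟨ cong₂ (λ s t → 1 + (s + t)) (positionSum-encode (a ∷ ms)) (trues-encode (a ∷ ms)) ⟩
    1 + (msum (a ∷ ms) + triangle s + s)
  ≡⟨ solve 3 (λ x t s → con 1 :+ (x :+ t :+ s) := x :+ (con 1 :+ s :+ t)) refl (msum (a ∷ ms)) (triangle s) s ⟩
    msum (a ∷ ms) + triangle (suc s)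
  ∎
  where
    s : ℕ
    s = msize (a ∷ ms)
positionSum-encode (zero ∷ [])     = refl
positionSum-encode (zero ∷ m ∷ ms) =
  begin
    positionSum (encode (m ∷ ms)) + trues (encode (m ∷ ms))
  ≡⟨ cong₂ _+_ (positionSum-encode (m ∷ ms)) (trues-encode (m ∷ ms)) ⟩
    msum (m ∷ ms) + triangle s + s
  ≡⟨ solve 3 (λ x t s → x :+ t :+ s := x :+ s :+ t) refl (msum (m ∷ ms)) (triangle s) s ⟩
    msum (m ∷ ms) + s + triangle s
  ≡⟨ cong (_+ triangle s) (msum-∷ 0 (m ∷ ms)) ⟨
    msum (0 ∷ m ∷ ms) + triangle s
  ∎
  where
    s : ℕ
    s = msize (m ∷ ms)

module _ {v : Vec ℕ (suc r)} {p : Subset k} (encode≡toList : encode v ≡ toList p) where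

  ∣p∣≡msize : ∣ p ∣ ≡ msize v
  ∣p∣≡msize = trans (∣p∣≡trues p) (trans (cong trues (sym encode≡toList)) (trues-encode v))

  subsetSum≡msum+triangle : subsetSum p ≡ msum v + triangle (msize v)
  subsetSum≡msum+triangle =
    trans (subsetSum≡positionSum p) (trans (cong positionSum (sym encode≡toList)) (positionSum-encode v))

nC2+triangle≡n*n : ∀ n → n C 2 + triangle n ≡ n * n
nC2+triangle≡n*n zero    = refl
nC2+triangle≡n*n (suc n) = begin
    suc n C 2 + (suc n + triangle n)
  ≡⟨ cong (_+ (suc n + triangle n)) (nCk+nC[k+1]≡[n+1]C[k+1] n 1) ⟨
    n C 1 + n C 2 + (suc n + triangle n)
  ≡⟨ cong (λ c → c + n C 2 + (suc n + triangle n)) (nC1≡n n) ⟩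
    n + n C 2 + (suc n + triangle n)
  ≡⟨ solve 3 (λ n c t → n :+ c :+ (con 1 :+ n :+ t) := n :+ (con 1 :+ n) :+ (c :+ t)) refl n (n C 2) (triangle n) ⟩
    n + suc n + (n C 2 + triangle n)
  ≡⟨ cong (n + suc n +_) (nC2+triangle≡n*n n) ⟩
    n + suc n + n * n
  ≡⟨ solve 1 (λ n → n :+ (con 1 :+ n) :+ n :* n := (con 1 :+ n) :* (con 1 :+ n)) refl n ⟩
    suc n * suc n
  ∎

module _ {d : ℕ} .{{_ : NonZero d}} where

  [m+k]%d≡m%d : ∀ m {k} → d ∣ k → (m + k) % d ≡ m % d
  [m+k]%d≡m%d m (divides q refl) = [m+kn]%n≡m%n m q d

  module _ {y z : ℕ} (d∣y+z : d ∣ y + z) where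

    ∣x+z⇒x%d≡y%d : ∀ x → d ∣ x + z → x % d ≡ y % d
    ∣x+z⇒x%d≡y%d x d∣x+z = begin
        x % d
      ≡⟨ [m+k]%d≡m%d x d∣y+z ⟨
        (x + (y + z)) % d
      ≡⟨ cong (_% d) (x∙yz≈y∙xz x y z) ⟩
        (y + (x + z)) % d
      ≡⟨ [m+k]%d≡m%d y d∣x+z ⟩
        y % d
      ∎

    x%d≡y%d⇒∣x+z : ∀ x → x % d ≡ y % d → d ∣ x + z
    x%d≡y%d⇒∣x+z x x≡y = m%n≡0⇒n∣m (x + z) d (begin
        (x + z) % d
      ≡⟨ %-distribˡ-+ x z d ⟩
        (x % d + z % d) % d
      ≡⟨ cong (λ t → (t + z % d) % d) x≡y ⟩
        (y % d + z % d) % d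
      ≡⟨ %-distribˡ-+ y z d ⟨
        (y + z) % d
      ≡⟨ n∣m⇒m%n≡0 (y + z) d d∣y+z ⟩
        0
      ∎)

egz↔goodSubsets : ∀ r → EGZ (suc r) ↔ GoodSubsets (suc r)
egz↔goodSubsets r =
  Σ-↔-irrelevant egz-irrelevant good-irrelevant to from to-good from-egz from-to to-from
  where
    n = suc r
    N = 2 * n ∸ 1

    n+r≡N : n + r ≡ N
    n+r≡N = solve 1 (λ r → (con 1 :+ r) :+ r := r :+ (con 1 :+ (r :+ con 0))) refl r

    n∣nC2+triangle : n ∣ n C 2 + triangle n
    n∣nC2+triangle = divides n (nC2+triangle≡n*n n)

    egz-irrelevant : ∀ {a b c d : ℕ} → Irrelevant (a ≡ b × c ≡ d)
    egz-irrelevant (a , b) (a′ , b′) = cong₂ _,_ (≡-irrelevant a a′) (≡-irrelevant b b′)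

    good-irrelevant : ∀ {a b c : ℕ} → Irrelevant (a ≡ b × n ∣ c)
    good-irrelevant (a , b) (a′ , b′) = cong₂ _,_ (≡-irrelevant a a′) (∣-irrelevant b b′)

    to : EGZ n → Subset N
    to (v , size≡n , _) = cast (trans (length-encode v) (trans (cong (_+ r) size≡n) n+r≡N)) (fromList (encode v))

    toList-to : ∀ x → encode (proj₁ x) ≡ toList (to x)
    toList-to (v , _) = sym (trans (toList-cast _ (fromList (encode v))) (toList∘fromList (encode v)))

    to-good : ∀ x → ∣ to x ∣ ≡ n × n ∣ subsetSum (to x)
    to-good x@(v , size≡n , sum≡) =
        trans (∣p∣≡msize (toList-to x)) size≡n
      , subst (n ∣_) (sym (trans (subsetSum≡msum+triangle (toList-to x)) (cong (λ s → msum v + triangle s) size≡n)))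
          (x%d≡y%d⇒∣x+z n∣nC2+triangle (msum v) sum≡)

    from : GoodSubsets n → Multiset n
    from (p , _) = decode r (toList p)

    encode-from : ∀ y → encode (from y) ≡ toList (proj₁ y)
    encode-from (p , ∣p∣≡n , _) = encode-decode r (toList p) (falses-toList p (sym n+r≡N) ∣p∣≡n)

    from-egz : ∀ y → msize (from y) ≡ n × msum (from y) % n ≡ (n C 2) % n
    from-egz y@(p , ∣p∣≡n , n∣sum) = size≡n
      , ∣x+z⇒x%d≡y%d n∣nC2+triangle (msum (from y))
          (subst (n ∣_) (trans (subsetSum≡msum+triangle (encode-from y)) (cong (λ s → msum (from y) + triangle s) size≡n)) n∣sum)
      where
        size≡n : msize (from y) ≡ n
        size≡n = trans (sym (∣p∣≡msize (encode-from y))) ∣p∣≡n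

    from-to : ∀ x → from (to x , to-good x) ≡ proj₁ x
    from-to x@(v , _) = trans (cong (decode r) (sym (toList-to x))) (decode-encode v)

    to-from : ∀ y → to (from y , from-egz y) ≡ proj₁ y
    to-from y@(p , _) = toList-injective _ (fromList (encode (from y))) p
      (trans (toList∘fromList (encode (from y))) (encode-from y))

lemma3 : (n : ℕ) → {{_ : NonZero n}} → EGZ n ⤖ GoodSubsets n
lemma3 (suc r) = ↔⇒⤖ (egz↔goodSubsets r)
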